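{- Let $m\in\{2,3,4\}$ and let $H$ be a $3$-uniform hypergraph with clique number $k\ge 3$. Let $N_1,\dots,N_\ell$ ($\ell\ge 3$) be $k$-cliques of $H$ with $\bigcap_{i=1}^{\ell}N_i=\varnothing$ and $\bigcap_{j\ne i}N_j\ne\varnothing$ for every $i$, and let $V=\bigcup_{i=1}^\ell N_i$, with $|V|=n$ and $m=n-k$. Suppose $p_1,\dots,p_\ell\subset V$ are $2$-element sets such that $p_i\subseteq N_j$ if and only if $i=j$. Let $G$ be the graph on vertex set $V$ with edge set $\{p_1,\dots,p_\ell\}$. For each $j$, let $G\setminus p_j$ be the graph on vertex set $V\setminus p_j$ whose edges/loops are the sets $p_h\setminus p_j$ for $h\ne j$, and define the weight $w(p_j)=m-\tau(G\setminus p_j)$. Let $V_0(G)=\bigcup_{i=1}^\ell p_i$, $Z(G)=V\setminus V_0(G)$ and $w(G)=\sum_{j=1}^{\ell}w(p_j)$. Then $$|V|=|V_0(G)|+|Z(G)|\le |V_0(G)|+w(G).$$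
   Context: A clique of a $3$-uniform hypergraph is a vertex set all of whose $3$-subsets are edges. For a graph possibly containing loops (a loop being a $1$-element set $\{v\}$), $\tau$ denotes the transversal number: the minimum size of a vertex set meeting every edge and every loop (so a loop $\{v\}$ forces $v$ into the transversal). -}

module Defs where

open import Data.Nat using (ℕ; zero; suc; _≤_)
open import Data.Integer using (ℤ; 0ℤ) renaming (_+_ to _+ℤ_)
open import Data.Fin using (Fin; zero; suc)
open import Data.Fin.Subset using (Subset; _⊆_; _∩_; Nonempty; ∣_∣; ⋃; ⋂)
open import Data.List using (List)
import Data.List as List
open import Data.Product using (Σ; ∃; _×_)
open import Relation.Binary.PropositionalEquality using (_≡_)

record Hypergraph3 (N : ℕ) : Set₁ where
  field
    Edge    : Subset N → Set
    uniform : ∀ e → Edge e → ∣ e ∣ ≡ 3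
open Hypergraph3 public

IsClique : ∀ {N} → Hypergraph3 N → Subset N → Set
IsClique H S = ∀ e → e ⊆ S → ∣ e ∣ ≡ 3 → Edge H e

IsKClique : ∀ {N} → Hypergraph3 N → ℕ → Subset N → Set
IsKClique H k S = IsClique H S × ∣ S ∣ ≡ k

CliqueNumber : ∀ {N} → Hypergraph3 N → ℕ → Set
CliqueNumber H k = (∃ λ S → IsKClique H k S) × (∀ S → IsClique H S → ∣ S ∣ ≤ k)

-- A graph possibly with loops: vertex set W and a family of edges/loops
-- (each a subset of W of size 1 or 2), indexed by a type I.
record LGraph (N : ℕ) : Set₁ where
  field
    Vert  : Subset N
    Idx   : Set
    edge  : Idx → Subset N
open LGraph public

IsTransversal : ∀ {N} → LGraph N → Subset N → Set
IsTransversal G T = T ⊆ Vert G × (∀ i → Nonempty (T ∩ edge G i))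

IsTau : ∀ {N} → LGraph N → ℕ → Set
IsTau G t = (∃ λ T → IsTransversal G T × ∣ T ∣ ≡ t)
          × (∀ T → IsTransversal G T → t ≤ ∣ T ∣)

⋃ᶠ : ∀ {N ℓ} → (Fin ℓ → Subset N) → Subset N
⋃ᶠ {ℓ = ℓ} A = ⋃ (List.tabulate {n = ℓ} A)

sumℤ : ∀ {ℓ} → (Fin ℓ → ℤ) → ℤ
sumℤ {zero}  f = 0ℤ
sumℤ {suc ℓ} f = f zero +ℤ sumℤ (λ i → f (suc i))

open import Data.Fin.Subset using (_─_)
open import Data.Product using (_,_)
open import Relation.Binary.PropositionalEquality using (_≢_)

deleteG : ∀ {N ℓ} → Subset N → (Fin ℓ → Subset N) → Fin ℓ → LGraph N
deleteG {ℓ = ℓ} V p j = record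
  { Vert = V ─ p j
  ; Idx  = Σ (Fin ℓ) (λ h → h ≢ j)
  ; edge = λ { (h , _) → p h ─ p j }
  }

-- Every vertex of Z = V ─ P misses some clique Nⱼ, as the cliques have no
-- common vertex; hence |Z| ≤ Σⱼ |Z ─ Nⱼ|. For a fixed j, the vertices of P
-- outside Nⱼ meet every pₕ with h ≠ j (since pₕ ⊈ Nⱼ) and avoid pⱼ ⊆ Nⱼ, so
-- they form a transversal of G ∖ pⱼ. Splitting V ─ Nⱼ, of size m, along P then
-- gives τ(G ∖ pⱼ) + |Z ─ Nⱼ| ≤ m, that is |Z ─ Nⱼ| ≤ w(pⱼ).
module Submission where

open import Defs
open import Data.Nat using (ℕ; _≤_; _+_)
open import Data.Integer using (ℤ; +_; _-_) renaming (_≤_ to _≤ℤ_; _+_ to _+ℤ_)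
open import Data.Fin using (Fin)
open import Data.Fin.Subset using (Subset; _∈_; _⊆_; _─_; ∣_∣)
open import Data.Product using (Σ; ∃; _×_; _,_)
open import Data.Sum using (_⊎_)
open import Relation.Nullary using (¬_)
open import Relation.Binary.PropositionalEquality using (_≡_; _≢_)
open import Function.Bundles using (_⇔_)

open import Data.Nat using (suc; _∸_; z≤n; s≤s)
import Data.Nat.Properties as ℕₚ
open import Data.Integer using (_⊖_; +≤+)
import Data.Integer.Properties as ℤₚ
open import Data.Fin using (zero; suc)
open import Data.Fin.Properties using (¬∀⟶∃¬)
open import Data.Fin.Subset using (inside; outside; _∉_; _∩_; _∪_; Nonempty)
open import Data.Fin.Subset.Properties
  using (_∈?_; nonempty?; x∈p∪q⁺; x∈p∪q⁻; x∈p∩q⁺; x∈p∩q⁻; x∈p∧x∉q⇒x∈p─q; p─q⊆p;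
         p∩q⊆q; p─q─r≡p─r─q; ⊆-antisym; p⊆q⇒∣p∣≤∣q∣; ∉⊥; ∣⊥∣≡0)
open import Data.Vec using (_∷_; []; here; there)
open import Data.Product using (proj₂)
open import Data.Sum using (inj₁; inj₂)
open import Data.Empty using (⊥-elim)
open import Relation.Nullary using (yes; no)
open import Relation.Binary.PropositionalEquality using (refl; sym; trans; cong; subst; module ≡-Reasoning)
open import Function using (_∘_)
open import Function.Bundles using (Equivalence)

x∈p─q⇒x∉q : ∀ {n} {x : Fin n} (p q : Subset n) → x ∈ p ─ q → x ∉ q
x∈p─q⇒x∉q (_ ∷ p) (_ ∷ q) (there x∈p─q) (there x∈q) = x∈p─q⇒x∉q p q x∈p─q x∈q
x∈p─q⇒x∉q (_ ∷ p) (inside ∷ q) () here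

p⊈q⇒Nonempty[p─q] : ∀ {n} (p q : Subset n) → ¬ p ⊆ q → Nonempty (p ─ q)
p⊈q⇒Nonempty[p─q] p q p⊈q with nonempty? (p ─ q)
... | yes ne = ne
... | no  e  = ⊥-elim (p⊈q p⊆q)
  where
  p⊆q : p ⊆ q
  p⊆q {x} x∈p with x ∈? q
  ... | yes x∈q = x∈q
  ... | no  x∉q = ⊥-elim (e (x , x∈p∧x∉q⇒x∈p─q x∈p x∉q))

∣p∣≡∣p∩q∣+∣p─q∣ : ∀ {n} (p q : Subset n) → ∣ p ∣ ≡ ∣ p ∩ q ∣ + ∣ p ─ q ∣
∣p∣≡∣p∩q∣+∣p─q∣ []            []            = refl
∣p∣≡∣p∩q∣+∣p─q∣ (inside  ∷ p) (inside  ∷ q) = cong suc (∣p∣≡∣p∩q∣+∣p─q∣ p q)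
∣p∣≡∣p∩q∣+∣p─q∣ (inside  ∷ p) (outside ∷ q) =
  trans (cong suc (∣p∣≡∣p∩q∣+∣p─q∣ p q)) (sym (ℕₚ.+-suc _ _))
∣p∣≡∣p∩q∣+∣p─q∣ (outside ∷ p) (inside  ∷ q) = ∣p∣≡∣p∩q∣+∣p─q∣ p q
∣p∣≡∣p∩q∣+∣p─q∣ (outside ∷ p) (outside ∷ q) = ∣p∣≡∣p∩q∣+∣p─q∣ p q

q⊆p⇒∣p∣≡∣q∣+∣p─q∣ : ∀ {n} {p q : Subset n} → q ⊆ p → ∣ p ∣ ≡ ∣ q ∣ + ∣ p ─ q ∣
q⊆p⇒∣p∣≡∣q∣+∣p─q∣ {p = p} {q} q⊆p =
  trans (∣p∣≡∣p∩q∣+∣p─q∣ p q) (cong (λ r → ∣ r ∣ + ∣ p ─ q ∣) p∩q≡q)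
  where
  p∩q≡q : p ∩ q ≡ q
  p∩q≡q = ⊆-antisym (p∩q⊆q p q) (λ x∈q → x∈p∩q⁺ (q⊆p x∈q , x∈q))

∣p∪q∣≤∣p∣+∣q∣ : ∀ {n} (p q : Subset n) → ∣ p ∪ q ∣ ≤ ∣ p ∣ + ∣ q ∣
∣p∪q∣≤∣p∣+∣q∣ []            []            = z≤n
∣p∪q∣≤∣p∣+∣q∣ (inside  ∷ p) (inside  ∷ q) =
  s≤s (ℕₚ.≤-trans (∣p∪q∣≤∣p∣+∣q∣ p q) (ℕₚ.+-monoʳ-≤ ∣ p ∣ (ℕₚ.n≤1+n ∣ q ∣)))
∣p∪q∣≤∣p∣+∣q∣ (inside  ∷ p) (outside ∷ q) = s≤s (∣p∪q∣≤∣p∣+∣q∣ p q)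
∣p∪q∣≤∣p∣+∣q∣ (outside ∷ p) (inside  ∷ q) =
  ℕₚ.≤-trans (s≤s (∣p∪q∣≤∣p∣+∣q∣ p q)) (ℕₚ.≤-reflexive (sym (ℕₚ.+-suc ∣ p ∣ ∣ q ∣)))
∣p∪q∣≤∣p∣+∣q∣ (outside ∷ p) (outside ∷ q) = ∣p∪q∣≤∣p∣+∣q∣ p q

x∈⋃ᶠ⁺ : ∀ {N ℓ} (A : Fin ℓ → Subset N) i {x} → x ∈ A i → x ∈ ⋃ᶠ A
x∈⋃ᶠ⁺ A zero    x∈A = x∈p∪q⁺ (inj₁ x∈A)
x∈⋃ᶠ⁺ A (suc i) x∈A = x∈p∪q⁺ (inj₂ (x∈⋃ᶠ⁺ (λ j → A (suc j)) i x∈A))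

⋃ᶠ-least : ∀ {N ℓ} {A : Fin ℓ → Subset N} {B : Subset N} → (∀ i → A i ⊆ B) → ⋃ᶠ A ⊆ B
⋃ᶠ-least {ℓ = 0}     A⊆B x∈⋃ = ⊥-elim (∉⊥ x∈⋃)
⋃ᶠ-least {ℓ = suc ℓ} {A} A⊆B x∈⋃ with x∈p∪q⁻ (A zero) _ x∈⋃
... | inj₁ x∈A₀ = A⊆B zero x∈A₀
... | inj₂ x∈⋃′ = ⋃ᶠ-least (λ i → A⊆B (suc i)) x∈⋃′

p⊆⋃ᶠ[p─A] : ∀ {N ℓ} (p : Subset N) (A : Fin ℓ → Subset N)
          → (∀ x → ¬ (∀ i → x ∈ A i)) → p ⊆ ⋃ᶠ (λ i → p ─ A i)
p⊆⋃ᶠ[p─A] {ℓ = ℓ} p A noCommon {x} x∈p with ¬∀⟶∃¬ ℓ (λ i → x ∈ A i) (λ i → x ∈? A i) (noCommon x)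
... | i , x∉Aᵢ = x∈⋃ᶠ⁺ (λ i → p ─ A i) i (x∈p∧x∉q⇒x∈p─q x∈p x∉Aᵢ)

sumℤ-mono-≤ : ∀ {ℓ} {f g : Fin ℓ → ℤ} → (∀ i → f i ≤ℤ g i) → sumℤ f ≤ℤ sumℤ g
sumℤ-mono-≤ {0}     f≤g = ℤₚ.≤-refl
sumℤ-mono-≤ {suc ℓ} f≤g = ℤₚ.+-mono-≤ (f≤g zero) (sumℤ-mono-≤ (λ i → f≤g (suc i)))

∣⋃ᶠ∣≤sumℤ : ∀ {N ℓ} (A : Fin ℓ → Subset N) → + ∣ ⋃ᶠ A ∣ ≤ℤ sumℤ (λ i → + ∣ A i ∣)
∣⋃ᶠ∣≤sumℤ {N} {ℓ = 0} A = ℤₚ.≤-reflexive (cong +_ (∣⊥∣≡0 N))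
∣⋃ᶠ∣≤sumℤ {ℓ = suc ℓ} A = begin
  + ∣ A zero ∪ ⋃ᶠ A′ ∣            ≤⟨ +≤+ (∣p∪q∣≤∣p∣+∣q∣ (A zero) (⋃ᶠ A′)) ⟩
  + (∣ A zero ∣ + ∣ ⋃ᶠ A′ ∣)      ≡⟨ ℤₚ.pos-+ ∣ A zero ∣ ∣ ⋃ᶠ A′ ∣ ⟩
  + ∣ A zero ∣ +ℤ + ∣ ⋃ᶠ A′ ∣     ≤⟨ ℤₚ.+-monoʳ-≤ (+ ∣ A zero ∣) (∣⋃ᶠ∣≤sumℤ A′) ⟩
  sumℤ (λ i → + ∣ A i ∣)          ∎
  where
  open ℤₚ.≤-Reasoning
  A′ : Fin ℓ → Subset _
  A′ i = A (suc i)

m+n≤o⇒+n≤+o-+m : ∀ {m n o} → m + n ≤ o → + n ≤ℤ + o - + m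
m+n≤o⇒+n≤+o-+m {m} {n} {o} m+n≤o = begin
  + n         ≤⟨ +≤+ (ℕₚ.m+n≤o⇒m≤o∸n n (ℕₚ.≤-trans (ℕₚ.≤-reflexive (ℕₚ.+-comm n m)) m+n≤o)) ⟩
  + (o ∸ m)   ≡⟨ ℤₚ.⊖-≥ (ℕₚ.m+n≤o⇒m≤o m m+n≤o) ⟨
  o ⊖ m       ≡⟨ ℤₚ.m-n≡m⊖n o m ⟨
  + o - + m   ∎
  where open ℤₚ.≤-Reasoning

outside-IsTransversal : ∀ {N ℓ} (V K : Subset N) (p : Fin ℓ → Subset N) (j : Fin ℓ)
  → (∀ h → p h ⊆ V) → p j ⊆ K → (∀ h → h ≢ j → ¬ p h ⊆ K)
  → IsTransversal (deleteG V p j) ((V ─ K) ∩ ⋃ᶠ p)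
outside-IsTransversal V K p j p⊆V pⱼ⊆K p⊈K = T⊆V─pⱼ , λ (h , h≢j) → meets h h≢j
  where
  T⊆V─pⱼ : (V ─ K) ∩ ⋃ᶠ p ⊆ V ─ p j
  T⊆V─pⱼ x∈T with x∈p∩q⁻ (V ─ K) (⋃ᶠ p) x∈T
  ... | x∈V─K , _ = x∈p∧x∉q⇒x∈p─q (p─q⊆p V K x∈V─K) (x∈p─q⇒x∉q V K x∈V─K ∘ pⱼ⊆K)

  meets : ∀ h → h ≢ j → Nonempty (((V ─ K) ∩ ⋃ᶠ p) ∩ (p h ─ p j))
  meets h h≢j with p⊈q⇒Nonempty[p─q] (p h) K (p⊈K h h≢j)
  ... | x , x∈pₕ─K =
    x , x∈p∩q⁺ (x∈p∩q⁺ (x∈p∧x∉q⇒x∈p─q (p⊆V h x∈pₕ) x∉K , x∈⋃ᶠ⁺ p h x∈pₕ)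
               , x∈p∧x∉q⇒x∈p─q x∈pₕ (x∉K ∘ pⱼ⊆K))
    where
    x∈pₕ = p─q⊆p (p h) K x∈pₕ─K
    x∉K  = x∈p─q⇒x∉q (p h) K x∈pₕ─K

IsTau⇒t+∣V─⋃ᶠp─K∣≤∣V─K∣ : ∀ {N ℓ} (V K : Subset N) (p : Fin ℓ → Subset N) (j : Fin ℓ) {t}
  → (∀ h → p h ⊆ V) → p j ⊆ K → (∀ h → h ≢ j → ¬ p h ⊆ K)
  → IsTau (deleteG V p j) t → t + ∣ V ─ ⋃ᶠ p ─ K ∣ ≤ ∣ V ─ K ∣
IsTau⇒t+∣V─⋃ᶠp─K∣≤∣V─K∣ V K p j {t} p⊆V pⱼ⊆K p⊈K (_ , τ-minimal) = begin
  t + ∣ V ─ P ─ K ∣                 ≤⟨ ℕₚ.+-mono-≤ t≤∣T∣ (ℕₚ.≤-reflexive (cong ∣_∣ (p─q─r≡p─r─q V P K))) ⟩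
  ∣ (V ─ K) ∩ P ∣ + ∣ V ─ K ─ P ∣   ≡⟨ ∣p∣≡∣p∩q∣+∣p─q∣ (V ─ K) P ⟨
  ∣ V ─ K ∣                         ∎
  where
  open ℕₚ.≤-Reasoning
  P = ⋃ᶠ p
  t≤∣T∣ : t ≤ ∣ (V ─ K) ∩ P ∣
  t≤∣T∣ = τ-minimal _ (outside-IsTransversal V K p j p⊆V pⱼ⊆K p⊈K)

lemma1 : (N : ℕ) (H : Hypergraph3 N) (k m ℓ : ℕ)
  → (m ≡ 2 ⊎ m ≡ 3 ⊎ m ≡ 4)
  → CliqueNumber H k → 3 ≤ k
  → 3 ≤ ℓ
  → (Nc : Fin ℓ → Subset N)
  → (∀ i → IsKClique H k (Nc i))
  → (∀ x → ¬ (∀ i → x ∈ Nc i))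
  → (∀ i → ∃ λ x → ∀ j → j ≢ i → x ∈ Nc j)
  → ∣ ⋃ᶠ Nc ∣ ≡ k + m
  → (p : Fin ℓ → Subset N)
  → (∀ i → ∣ p i ∣ ≡ 2)
  → (∀ i → p i ⊆ ⋃ᶠ Nc)
  → (∀ i j → (p i ⊆ Nc j) ⇔ (i ≡ j))
  → (τ : Fin ℓ → ℕ)
  → (∀ j → IsTau (deleteG (⋃ᶠ Nc) p j) (τ j))
  → (∣ ⋃ᶠ Nc ∣ ≡ ∣ ⋃ᶠ p ∣ + ∣ ⋃ᶠ Nc ─ ⋃ᶠ p ∣)
    × (+ ∣ ⋃ᶠ Nc ∣ ≤ℤ + ∣ ⋃ᶠ p ∣ +ℤ sumℤ (λ j → + m - + τ j))
lemma1 N H k m ℓ _ _ _ _ Nc cliques noCommon _ ∣V∣≡k+m p _ p⊆V pᵢ⊆Nⱼ⇔i≡j τ isTau =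
  ∣V∣≡∣P∣+∣Z∣ , weight-bound
  where
  V = ⋃ᶠ Nc
  P = ⋃ᶠ p
  Z = V ─ P

  ∣V∣≡∣P∣+∣Z∣ : ∣ V ∣ ≡ ∣ P ∣ + ∣ Z ∣
  ∣V∣≡∣P∣+∣Z∣ = q⊆p⇒∣p∣≡∣q∣+∣p─q∣ (⋃ᶠ-least p⊆V)

  ∣V─Nⱼ∣≡m : ∀ j → ∣ V ─ Nc j ∣ ≡ m
  ∣V─Nⱼ∣≡m j = ℕₚ.+-cancelˡ-≡ k _ _ (begin
    k + ∣ V ─ Nc j ∣       ≡⟨ cong (_+ ∣ V ─ Nc j ∣) (proj₂ (cliques j)) ⟨
    ∣ Nc j ∣ + ∣ V ─ Nc j ∣ ≡⟨ q⊆p⇒∣p∣≡∣q∣+∣p─q∣ (x∈⋃ᶠ⁺ Nc j) ⟨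
    ∣ V ∣                   ≡⟨ ∣V∣≡k+m ⟩
    k + m                   ∎)
    where open ≡-Reasoning

  ∣Z─Nⱼ∣≤w[pⱼ] : ∀ j → + ∣ Z ─ Nc j ∣ ≤ℤ + m - + τ j
  ∣Z─Nⱼ∣≤w[pⱼ] j = m+n≤o⇒+n≤+o-+m (subst (τ j + ∣ Z ─ Nc j ∣ ≤_) (∣V─Nⱼ∣≡m j)
    (IsTau⇒t+∣V─⋃ᶠp─K∣≤∣V─K∣ V (Nc j) p j p⊆V
      (Equivalence.from (pᵢ⊆Nⱼ⇔i≡j j j) refl)
      (λ h h≢j → h≢j ∘ Equivalence.to (pᵢ⊆Nⱼ⇔i≡j h j))
      (isTau j)))

  weight-bound : + ∣ V ∣ ≤ℤ + ∣ P ∣ +ℤ sumℤ (λ j → + m - + τ j)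
  weight-bound = begin
    + ∣ V ∣                               ≡⟨ cong +_ ∣V∣≡∣P∣+∣Z∣ ⟩
    + (∣ P ∣ + ∣ Z ∣)                     ≡⟨ ℤₚ.pos-+ ∣ P ∣ ∣ Z ∣ ⟩
    + ∣ P ∣ +ℤ + ∣ Z ∣                    ≤⟨ ℤₚ.+-monoʳ-≤ (+ ∣ P ∣) (+≤+ (p⊆q⇒∣p∣≤∣q∣ (p⊆⋃ᶠ[p─A] Z Nc noCommon))) ⟩
    + ∣ P ∣ +ℤ + ∣ ⋃ᶠ (λ j → Z ─ Nc j) ∣  ≤⟨ ℤₚ.+-monoʳ-≤ (+ ∣ P ∣) (∣⋃ᶠ∣≤sumℤ (λ j → Z ─ Nc j)) ⟩
    + ∣ P ∣ +ℤ sumℤ (λ j → + ∣ Z ─ Nc j ∣) ≤⟨ ℤₚ.+-monoʳ-≤ (+ ∣ P ∣) (sumℤ-mono-≤ ∣Z─Nⱼ∣≤w[pⱼ]) ⟩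
    + ∣ P ∣ +ℤ sumℤ (λ j → + m - + τ j)   ∎
    where open ℤₚ.≤-Reasoning
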